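{- Let $\mathcal M=(X,d_a,d_b,[\![\cdot]\!])$ be a bitopological derivative model, with $d_a,d_b$ the Cantor derivatives of topologies $\mathcal T_a,\mathcal T_b$ on $X$, such that ${\tt Two}$ is true at every point of $\mathcal M$. Let $S:=S_b\circ S_a$ and let $\mathcal M^{\sf PLTL}:=(X,S,[\![\cdot]\!])$. Then for every $\varphi\in\mathcal L^{\sf PLTL}$ and every $x\in X$, $(\mathcal M,x)\models\varphi^{\rm top}$ iff $(\mathcal M^{\sf PLTL},x)\models\varphi$.
   Context: Language $\mathcal L^*$: formulas $\varphi::=p\mid\neg\varphi\mid\varphi\wedge\psi\mid\langle\alpha\rangle\varphi$, programs $\alpha::=a\mid\alpha;\beta\mid\alpha\cup\beta\mid\alpha^*$; $[\alpha]\varphi:=\neg\langle\alpha\rangle\neg\varphi$. In $\mathcal M$, $[\![a]\!](Y)=d_a(Y)$, $[\![b]\!](Y)=d_b(Y)$, $[\![\alpha;\beta]\!](Y)=[\![\alpha]\!]([\![\beta]\!](Y))$, $[\![\alpha\cup\beta]\!](Y)=[\![\alpha]\!](Y)\cup[\![\beta]\!](Y)$, $[\![\alpha^*]\!](Y)=\bigcap\{Z:[\![\alpha]\!](Z)\cup Y\subseteq Z\}$, and $[\![\langle\alpha\rangle\varphi]\!]=[\![\alpha]\!]([\![\varphi]\!])$. The Cantor derivative of $\mathcal T$ is $d_{\mathcal T}(A)=\{y:\text{every }\mathcal T\text{ -neighbourhood of }y\text{ meets }A\setminus\{y\}\}$. With a designated atom ${\tt whole}$, ${\tt Two}_\iota:=({\tt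 whole}\to([\iota]\neg{\tt whole}\wedge\langle\iota\rangle\neg{\tt whole}))\wedge(\neg{\tt whole}\to([\iota]{\tt whole}\wedge\langle\iota\rangle{\tt whole}))$ for $\iota\in\{a,b\}$, and ${\tt Two}:={\tt Two}_a\wedge{\tt Two}_b$. Under the hypothesis, for each $\iota\in\{a,b\}$ and $x\in X$ there is a unique $y\neq x$ with $\{x,y\}\in\mathcal T_\iota$ and no nonempty proper subset of $\{x,y\}$ in $\mathcal T_\iota$; this $y$ is $S_\iota(x)$, and $S_a,S_b,S$ are bijections. $\mathcal L^{\sf PLTL}$: $\varphi::=p\mid\neg\varphi\mid\varphi\wedge\psi\mid\mathsf X\varphi\mid\mathsf Y\varphi\mid\mathsf F\varphi\mid\mathsf P\varphi$, interpreted on $(X,S,[\![\cdot]\!])$ with $S$ a bijection: $w\models\mathsf X\varphi$ iff $S(w)\models\varphi$; $w\models\mathsf Y\varphi$ iff $S^{ -1}(w)\models\varphi$; $w\models\mathsf F\varphi$ iff $S^k(w)\models\varphi$ for some $k\ge0$; $w\models\mathsf P\varphi$ iff $S^{ -k}(w)\models\varphi$ for some $k\ge0$. The translation $\cdot^{\rm top}:\mathcal L^{\sf PLTL}\to\mathcal L^*$ fixes atoms, commutes with Booleans, and sets $(\mathsf X\varphi)^{\rm top}=\langle a;b\rangle\varphi^{\rm top}$, $(\mathsf Y\varphi)^{\rm top}=\langle b;a\rangle\varphi^{\rm top}$, $(\mathsf F\varphi)^{\rm top}=\langle(a;b)^*\rangle\varphi^{\rm top}$, $(\mathsf P\varphi)^{\rm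 top}=\langle(b;a)^*\rangle\varphi^{\rm top}$. -}

module Defs where

open import Level using (Level; 0ℓ; _⊔_) renaming (suc to lsuc)
open import Data.Nat using (ℕ; zero; suc)
open import Data.Product using (Σ; ∃; _×_; _,_)
open import Data.Sum using (_⊎_)
open import Relation.Unary using (Pred; U; _⊆_; _≐_; _∪_; _∩_; ∁; Satisfiable)
open import Relation.Binary.PropositionalEquality using (_≡_; _≢_)
open import Function using (_∘_)

record Topology (X : Set) : Set₁ where
  field
    Open      : Pred X 0ℓ → Set
    open-resp : ∀ {V W : Pred X 0ℓ} → V ≐ W → Open V → Open W
    open-univ : Open U
    open-⋃    : (I : Set) (F : I → Pred X 0ℓ) → (∀ i → Open (F i)) →
                Open (λ x → ∃ λ i → F i x)
    open-∩    : ∀ {V W : Pred X 0ℓ} → Open V → Open W → Open (V ∩ W)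

open Topology public

cantor : {X : Set} {ℓ : Level} → Topology X → Pred X ℓ → Pred X (lsuc 0ℓ ⊔ ℓ)
cantor {X} T A y = (V : Pred X 0ℓ) → Open T V → V y → ∃ λ z → V z × A z × z ≢ y

data Prog : Set where
  pa pb  : Prog
  seq    : Prog → Prog → Prog
  choice : Prog → Prog → Prog
  star   : Prog → Prog

data Form : Set where
  atom : ℕ → Form
  neg  : Form → Form
  conj : Form → Form → Form
  dia  : Prog → Form → Form

box : Prog → Form → Form
box α φ = neg (dia α (neg φ))

impl : Form → Form → Form
impl φ ψ = neg (conj φ (neg ψ))

record BiModel (X : Set) : Set₁ where
  field
    Ta Tb : Topology X
    val   : ℕ → Pred X 0ℓ

open BiModel public

-- universe bookkeeping (predicative rendering of the semantics)
plev : Prog → Level → Level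
plev pa ℓ = lsuc 0ℓ ⊔ ℓ
plev pb ℓ = lsuc 0ℓ ⊔ ℓ
plev (seq α β) ℓ = plev α (plev β ℓ)
plev (choice α β) ℓ = plev α ℓ ⊔ plev β ℓ
plev (star α) ℓ = lsuc ℓ ⊔ plev α ℓ

flev : Form → Level
flev (atom p) = 0ℓ
flev (neg φ) = flev φ
flev (conj φ ψ) = flev φ ⊔ flev ψ
flev (dia α φ) = plev α (flev φ)

⟦_⟧p : {X : Set} {ℓ : Level} (α : Prog) → BiModel X → Pred X ℓ → Pred X (plev α ℓ)
⟦ pa ⟧p M Y = cantor (Ta M) Y
⟦ pb ⟧p M Y = cantor (Tb M) Y
⟦ seq α β ⟧p M Y = ⟦ α ⟧p M (⟦ β ⟧p M Y)
⟦ choice α β ⟧p M Y = ⟦ α ⟧p M Y ∪ ⟦ β ⟧p M Y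
⟦_⟧p {X} {ℓ} (star α) M Y = λ x → (Z : Pred X ℓ) → (⟦ α ⟧p M Z ∪ Y) ⊆ Z → Z x

⟦_⟧ : {X : Set} (φ : Form) → BiModel X → Pred X (flev φ)
⟦ atom p ⟧ M = val M p
⟦ neg φ ⟧ M = ∁ (⟦ φ ⟧ M)
⟦ conj φ ψ ⟧ M = ⟦ φ ⟧ M ∩ ⟦ ψ ⟧ M
⟦ dia α φ ⟧ M = ⟦ α ⟧p M (⟦ φ ⟧ M)

Two₁ : ℕ → Prog → Form
Two₁ whole ι =
  conj (impl (atom whole) (conj (box ι (neg (atom whole))) (dia ι (neg (atom whole)))))
       (impl (neg (atom whole)) (conj (box ι (atom whole)) (dia ι (atom whole))))

Two : ℕ → Form
Two whole = conj (Two₁ whole pa) (Two₁ whole pb)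

pair : {X : Set} → X → X → Pred X 0ℓ
pair x y z = z ≡ x ⊎ z ≡ y

IsSucc : {X : Set} → Topology X → (X → X) → Set₁
IsSucc {X} T Sι = ∀ x →
  (Sι x ≢ x) ×
  Open T (pair x (Sι x)) ×
  ((V : Pred X 0ℓ) → Open T V → V ⊆ pair x (Sι x) → Satisfiable V →
      pair x (Sι x) ⊆ V)

data PForm : Set where
  patom : ℕ → PForm
  pneg  : PForm → PForm
  pconj : PForm → PForm → PForm
  nxt prv fut pst : PForm → PForm

iter : {A : Set} → (A → A) → ℕ → A → A
iter f zero a = a
iter f (suc n) a = f (iter f n a)

-- satisfaction on (X, S, val); S⁻¹(w) ⊨ φ rendered as "the preimage v of w
-- under S satisfies φ" (S is a bijection in the intended application).
Sat : {W : Set} → (W → W) → (ℕ → Pred W 0ℓ) → PForm → Pred W 0ℓ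
Sat S v (patom p) w = v p w
Sat S v (pneg φ) w = ∁ (Sat S v φ) w
Sat S v (pconj φ ψ) w = Sat S v φ w × Sat S v ψ w
Sat S v (nxt φ) w = Sat S v φ (S w)
Sat S v (prv φ) w = ∃ λ u → S u ≡ w × Sat S v φ u
Sat S v (fut φ) w = ∃ λ k → Sat S v φ (iter S k w)
Sat S v (pst φ) w = ∃ λ k → ∃ λ u → iter S k u ≡ w × Sat S v φ u

top : PForm → Form
top (patom p) = atom p
top (pneg φ) = neg (top φ)
top (pconj φ ψ) = conj (top φ) (top ψ)
top (nxt φ) = dia (seq pa pb) (top φ)
top (prv φ) = dia (seq pb pa) (top φ)
top (fut φ) = dia (star (seq pa pb)) (top φ)
top (pst φ) = dia (star (seq pb pa)) (top φ)

{-# OPTIONS --safe #-}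
module Submission where

-- Since {x, S_ι x} is a minimal open set and S_ι x ≠ x, the Cantor derivative
-- d_ι(Y) is exactly the preimage S_ι⁻¹(Y), and S_ι is an involution.  Hence
-- ⟨a;b⟩ and ⟨b;a⟩ are the preimage operators of S = S_b ∘ S_a and of its
-- inverse S_a ∘ S_b, and the least-fixed-point semantics of α* for such an α
-- collects exactly the points reached by iterating.

open import Defs
open import Level using (Setω)
open import Data.Nat using (ℕ; zero; suc)
open import Data.Product using (∃; _×_; _,_; proj₁; proj₂)
open import Data.Product.Function.NonDependent.Propositional using (_×-⇔_)
import Data.Product.Function.Dependent.Propositional as Σ
open import Data.Sum using (inj₁; inj₂)
open import Data.Empty using (⊥-elim)
open import Relation.Unary using (Pred; _⊆_; _∩_; _∪_)
open import Relation.Binary.PropositionalEquality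
  using (_≡_; _≢_; _≗_; refl; sym; trans; cong; subst; module ≡-Reasoning)
open import Function using (_∘_; id; _⇔_; mk⇔; Equivalence)
open import Function.Related.TypeIsomorphisms using (¬-cong-⇔)
import Function.Properties.Equivalence as ⇔

module _ {W : Set} {T : Topology W} {Sι : W → W} (succ : IsSucc T Sι) where

  succ-moves : ∀ x → Sι x ≢ x
  succ-moves x = proj₁ (succ x)

  pair-open : ∀ x → Open T (pair x (Sι x))
  pair-open x = proj₁ (proj₂ (succ x))

  open-meeting-pair⇒pair⊆ : ∀ {V : Pred W _} x {y} → Open T V →
                            pair x (Sι x) y → V y → pair x (Sι x) ⊆ V
  open-meeting-pair⇒pair⊆ {V} x {y} V-open y∈pair Vy z∈pair =
    proj₁ (proj₂ (proj₂ (succ x)) (V ∩ pair x (Sι x))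
             (open-∩ T V-open (pair-open x)) proj₂ (y , Vy , y∈pair) z∈pair)

  cantor⇔succ : ∀ {ℓ} (Y : Pred W ℓ) x → cantor T Y x ⇔ Y (Sι x)
  cantor⇔succ Y x = mk⇔ to from
    where
    to : cantor T Y x → Y (Sι x)
    to dY with dY (pair x (Sι x)) (pair-open x) (inj₁ refl)
    ... | _ , inj₁ z≡x  , _  , z≢x = ⊥-elim (z≢x z≡x)
    ... | _ , inj₂ z≡Sx , Yz , _   = subst Y z≡Sx Yz

    from : Y (Sι x) → cantor T Y x
    from YSx V V-open Vx =
      Sι x , open-meeting-pair⇒pair⊆ x V-open (inj₁ refl) Vx (inj₂ refl) ,
      YSx , succ-moves x

  succ-involutive : Sι ∘ Sι ≗ id
  succ-involutive x
    with open-meeting-pair⇒pair⊆ (Sι x) (pair-open x)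
           (inj₁ refl) (inj₂ refl) (inj₂ refl)
  ... | inj₁ SSx≡x  = SSx≡x
  ... | inj₂ SSx≡Sx = ⊥-elim (succ-moves (Sι x) SSx≡Sx)

iter-suc : {A : Set} (f : A → A) (k : ℕ) (a : A) → iter f (suc k) a ≡ iter f k (f a)
iter-suc f zero    a = refl
iter-suc f (suc k) a = cong f (iter-suc f k a)

record IsPreimage {W : Set} (M : BiModel W) (α : Prog) (f : W → W) : Setω where
  field
    preimage : ∀ {ℓ} (Y : Pred W ℓ) x → ⟦ α ⟧p M Y x ⇔ Y (f x)

open IsPreimage

module _ {W : Set} {M : BiModel W} where

  pa-preimage : ∀ {Sa} → IsSucc (Ta M) Sa → IsPreimage M pa Sa
  pa-preimage Sa-succ = record { preimage = cantor⇔succ {T = Ta M} Sa-succ }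

  pb-preimage : ∀ {Sb} → IsSucc (Tb M) Sb → IsPreimage M pb Sb
  pb-preimage Sb-succ = record { preimage = cantor⇔succ {T = Tb M} Sb-succ }

  seq-preimage : ∀ {α β f g} → IsPreimage M α f → IsPreimage M β g →
                 IsPreimage M (seq α β) (g ∘ f)
  seq-preimage {β = β} {f} α≡f⁻¹ β≡g⁻¹ = record { preimage = λ Y x →
    ⇔.trans (preimage α≡f⁻¹ (⟦ β ⟧p M Y) x) (preimage β≡g⁻¹ Y (f x)) }

  star-preimage : ∀ {α f} → IsPreimage M α f →
                  ∀ {ℓ} (Y : Pred W ℓ) x →
                  ⟦ star α ⟧p M Y x ⇔ ∃ λ k → Y (iter f k x)
  star-preimage {α} {f} α≡f⁻¹ Y x =
    mk⇔ (λ α*Y → α*Y Reach Reach-closed)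
        (λ (k , Y-fᵏx) Z Z-closed → Reach⊆ Z-closed k x Y-fᵏx)
    where
    Reach : Pred W _
    Reach y = ∃ λ k → Y (iter f k y)

    Reach-closed : ⟦ α ⟧p M Reach ∪ Y ⊆ Reach
    Reach-closed {y} (inj₁ α-Reach-y)
      with Equivalence.to (preimage α≡f⁻¹ Reach y) α-Reach-y
    ... | k , Y-fᵏfy = suc k , subst Y (sym (iter-suc f k y)) Y-fᵏfy
    Reach-closed (inj₂ Yy) = zero , Yy

    Reach⊆ : ∀ {Z : Pred W _} → ⟦ α ⟧p M Z ∪ Y ⊆ Z →
             ∀ k y → Y (iter f k y) → Z y
    Reach⊆ Z-closed zero y Yy = Z-closed (inj₂ Yy)
    Reach⊆ {Z} Z-closed (suc k) y Y-fᵏ⁺¹y =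
      Z-closed (inj₁ (Equivalence.from (preimage α≡f⁻¹ Z y) Z-fy))
      where
      Z-fy : Z (f y)
      Z-fy = Reach⊆ Z-closed k (f y) (subst Y (iter-suc f k y) Y-fᵏ⁺¹y)

module _ {A : Set} (f g : A → A) where

  iter-inverse : g ∘ f ≗ id → ∀ k → iter g k ∘ iter f k ≗ id
  iter-inverse g∘f≗id zero    x = refl
  iter-inverse g∘f≗id (suc k) x = begin
    iter g (suc k) (iter f (suc k) x) ≡⟨ iter-suc g k _ ⟩
    iter g k (g (f (iter f k x)))     ≡⟨ cong (iter g k) (g∘f≗id _) ⟩
    iter g k (iter f k x)             ≡⟨ iter-inverse g∘f≗id k x ⟩
    x                                 ∎
    where open ≡-Reasoning

  reverse-composite-inverse : f ∘ f ≗ id → g ∘ g ≗ id → (g ∘ f) ∘ (f ∘ g) ≗ id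
  reverse-composite-inverse f∘f≗id g∘g≗id x =
    trans (cong g (f∘f≗id (g x))) (g∘g≗id x)

  preimage⇔image : f ∘ g ≗ id → g ∘ f ≗ id →
                   ∀ {ℓ} (P : Pred A ℓ) x → P (g x) ⇔ ∃ λ u → f u ≡ x × P u
  preimage⇔image f∘g≗id g∘f≗id P x =
    mk⇔ (λ Pgx → g x , f∘g≗id x , Pgx)
        (λ (u , fu≡x , Pu) → subst P (trans (sym (g∘f≗id u)) (cong g fu≡x)) Pu)

module _ {W : Set} (M : BiModel W) {S S⁻¹ : W → W}
         (next : IsPreimage M (seq pa pb) S) (prev : IsPreimage M (seq pb pa) S⁻¹)
         (S∘S⁻¹≗id : S ∘ S⁻¹ ≗ id) (S⁻¹∘S≗id : S⁻¹ ∘ S ≗ id) where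

  top-correct : ∀ φ x → ⟦ top φ ⟧ M x ⇔ Sat S (val M) φ x
  top-correct (patom p)   x = ⇔.refl
  top-correct (pneg φ)    x = ¬-cong-⇔ (top-correct φ x)
  top-correct (pconj φ ψ) x = top-correct φ x ×-⇔ top-correct ψ x
  top-correct (nxt φ)     x = ⇔.trans (preimage next _ x) (top-correct φ (S x))
  top-correct (prv φ)     x =
    ⇔.trans (preimage prev _ x)
      (⇔.trans (top-correct φ (S⁻¹ x))
        (preimage⇔image S S⁻¹ S∘S⁻¹≗id S⁻¹∘S≗id _ x))
  top-correct (fut φ)     x =
    ⇔.trans (star-preimage next _ x) (Σ.congˡ λ {k} → top-correct φ (iter S k x))
  top-correct (pst φ)     x =
    ⇔.trans (star-preimage prev _ x) (Σ.congˡ λ {k} →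
      ⇔.trans (top-correct φ (iter S⁻¹ k x))
        (preimage⇔image (iter S k) (iter S⁻¹ k)
           (iter-inverse S⁻¹ S S∘S⁻¹≗id k) (iter-inverse S S⁻¹ S⁻¹∘S≗id k) _ x))

mainTheorem5 : {W : Set} (M : BiModel W) (whole : ℕ) →
    (∀ x → ⟦ Two whole ⟧ M x) →
    (Sa Sb : W → W) → IsSucc (Ta M) Sa → IsSucc (Tb M) Sb →
    (φ : PForm) (x : W) → ⟦ top φ ⟧ M x ⇔ Sat (Sb ∘ Sa) (val M) φ x
mainTheorem5 M _ _ Sa Sb Sa-succ Sb-succ =
  top-correct M (seq-preimage (pa-preimage Sa-succ) (pb-preimage Sb-succ))
                (seq-preimage (pb-preimage Sb-succ) (pa-preimage Sa-succ))
                (reverse-composite-inverse Sa Sb Sa-involutive Sb-involutive)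
                (reverse-composite-inverse Sb Sa Sb-involutive Sa-involutive)
  where
  Sa-involutive : Sa ∘ Sa ≗ id
  Sa-involutive = succ-involutive {T = Ta M} Sa-succ

  Sb-involutive : Sb ∘ Sb ≗ id
  Sb-involutive = succ-involutive {T = Tb M} Sb-succ
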